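{- For every integer $n\ge 0$, there is a bijection between the set of doubly rooted plane trees with $n$ edges and the set of bicolored plane trees with $n$ edges.
   Context: A plane tree is a rooted tree in which the children of each vertex are linearly ordered. A doubly rooted plane tree is a plane tree together with a distinguished vertex (possibly the root). A bicolored plane tree is a plane tree in which each child of the root is colored with one of two colors (black or white); no other vertices are colored. -}

module Defs where

open import Data.Nat using (ℕ; suc; _+_)
open import Data.List using (List; []; _∷_)
open import Data.List.Membership.Propositional using (_∈_)
open import Data.Bool using (Bool)
open import Data.Product using (Σ; _×_; Σ-syntax; _,_)
open import Relation.Binary.PropositionalEquality using (_≡_)

data PlaneTree : Set where
  node : List PlaneTree → PlaneTree

mutual
  edges : PlaneTree → ℕ
  edges (node ts) = edgesF ts

  edgesF : List PlaneTree → ℕ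
  edgesF [] = 0
  edgesF (t ∷ ts) = suc (edges t) + edgesF ts

-- Vertices of a plane tree: either the root, or a vertex of one of
-- the (position-indexed) subtrees of the root.
data Vertex : PlaneTree → Set where
  here  : ∀ {ts} → Vertex (node ts)
  there : ∀ {ts t} → (p : t ∈ ts) → Vertex t → Vertex (node ts)

DoublyRooted : ℕ → Set
DoublyRooted n = Σ[ t ∈ PlaneTree ] (edges t ≡ n × Vertex t)

-- Bicolored plane trees: the children of the root each carry a colour
-- (Bool: black/white); deeper vertices are uncoloured.
edgesB : List (Bool × PlaneTree) → ℕ
edgesB [] = 0
edgesB ((_ , t) ∷ cts) = suc (edges t) + edgesB cts

Bicolored : ℕ → Set
Bicolored n = Σ[ cts ∈ List (Bool × PlaneTree) ] (edgesB cts ≡ n)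

-- Follow the path from the root to the distinguished vertex v.  At each
-- vertex on the path, record the siblings to the left of the path as white
-- root children, and bundle the siblings to its right under a fresh root,
-- recorded as one black root child; at v itself record all children as
-- white.  Each black child marks one step down the path, so the list of
-- coloured trees can be read back, and every edge is counted exactly once
-- (the edge into the path child becomes the edge above the black tree).
module Submission where

open import Defs
open import Data.Nat using (ℕ; suc; _+_)
open import Data.Nat.Properties using (≡-irrelevant; +-comm)
open import Data.List using (List; []; _∷_; map)
open import Data.List.Relation.Unary.Any using (here; there)
open import Data.List.Membership.Propositional using (_∈_)
open import Data.Bool using (Bool; true; false)
open import Data.Product using (Σ; _×_; _,_; proj₁; proj₂)
open import Relation.Binary.PropositionalEquality
  using (_≡_; refl; cong; trans; sym; module ≡-Reasoning)
open import Function.Bundles using (_⤖_; mk↔ₛ′)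
open import Function.Properties.Inverse using (↔⇒⤖)

Pointed : Set
Pointed = Σ PlaneTree Vertex

white : PlaneTree → Bool × PlaneTree
white t = false , t

mutual
  spine : (t : PlaneTree) → Vertex t → List (Bool × PlaneTree)
  spine (node ts) here        = map white ts
  spine (node ts) (there p v) = spineF ts p v

  spineF : (ts : List PlaneTree) → ∀ {t} → t ∈ ts → Vertex t → List (Bool × PlaneTree)
  spineF (t ∷ ts) (here refl) v = (true , node ts) ∷ spine t v
  spineF (u ∷ ts) (there p)   v = white u ∷ spineF ts p v

spine′ : Pointed → List (Bool × PlaneTree)
spine′ (t , v) = spine t v

pushLeft : PlaneTree → Pointed → Pointed
pushLeft u (node ts , here)      = node (u ∷ ts) , here
pushLeft u (node ts , there p v) = node (u ∷ ts) , there (there p) v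

hangLeftOf : List PlaneTree → Pointed → Pointed
hangLeftOf ts (t , v) = node (t ∷ ts) , there (here refl) v

rebuild : List (Bool × PlaneTree) → Pointed
rebuild []                       = node [] , here
rebuild ((false , u) ∷ cts)      = pushLeft u (rebuild cts)
rebuild ((true , node ts) ∷ cts) = hangLeftOf ts (rebuild cts)

mutual
  edgesB-spine : (t : PlaneTree) (v : Vertex t) → edgesB (spine t v) ≡ edges t
  edgesB-spine (node ts) here        = edgesB-map-white ts
  edgesB-spine (node ts) (there p v) = edgesB-spineF ts p v

  edgesB-map-white : (ts : List PlaneTree) → edgesB (map white ts) ≡ edgesF ts
  edgesB-map-white []       = refl
  edgesB-map-white (u ∷ ts) = cong (suc (edges u) +_) (edgesB-map-white ts)

  edgesB-spineF : (ts : List PlaneTree) → ∀ {t} (p : t ∈ ts) (v : Vertex t) →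
                  edgesB (spineF ts p v) ≡ edgesF ts
  edgesB-spineF (t ∷ ts) (here refl) v = begin
    suc (edgesF ts) + edgesB (spine t v) ≡⟨ cong (suc (edgesF ts) +_) (edgesB-spine t v) ⟩
    suc (edgesF ts + edges t)            ≡⟨ cong suc (+-comm (edgesF ts) (edges t)) ⟩
    suc (edges t + edgesF ts)            ∎
    where open ≡-Reasoning
  edgesB-spineF (u ∷ ts) (there p) v = cong (suc (edges u) +_) (edgesB-spineF ts p v)

spine-pushLeft : ∀ u x → spine′ (pushLeft u x) ≡ white u ∷ spine′ x
spine-pushLeft u (node ts , here)      = refl
spine-pushLeft u (node ts , there p v) = refl

spine-rebuild : ∀ cts → spine′ (rebuild cts) ≡ cts
spine-rebuild []                       = refl
spine-rebuild ((false , u) ∷ cts)      =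
  trans (spine-pushLeft u (rebuild cts)) (cong (white u ∷_) (spine-rebuild cts))
spine-rebuild ((true , node ts) ∷ cts) = cong ((true , node ts) ∷_) (spine-rebuild cts)

mutual
  rebuild-spine : (t : PlaneTree) (v : Vertex t) → rebuild (spine t v) ≡ (t , v)
  rebuild-spine (node ts) here        = rebuild-map-white ts
  rebuild-spine (node ts) (there p v) = rebuild-spineF ts p v

  rebuild-map-white : (ts : List PlaneTree) → rebuild (map white ts) ≡ (node ts , here)
  rebuild-map-white []       = refl
  rebuild-map-white (u ∷ ts) = cong (pushLeft u) (rebuild-map-white ts)

  rebuild-spineF : (ts : List PlaneTree) → ∀ {t} (p : t ∈ ts) (v : Vertex t) →
                   rebuild (spineF ts p v) ≡ (node ts , there p v)
  rebuild-spineF (t ∷ ts) (here refl) v = cong (hangLeftOf ts) (rebuild-spine t v)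
  rebuild-spineF (u ∷ ts) (there p)   v = cong (pushLeft u) (rebuild-spineF ts p v)

edges-rebuild : ∀ cts → edges (proj₁ (rebuild cts)) ≡ edgesB cts
edges-rebuild cts = let (t , v) = rebuild cts in
  trans (sym (edgesB-spine t v)) (cong edgesB (spine-rebuild cts))

module _ {n : ℕ} where

  Bicolored-≡ : ∀ {cts cts′} {e : edgesB cts ≡ n} {e′ : edgesB cts′ ≡ n} →
                cts ≡ cts′ → _≡_ {A = Bicolored n} (cts , e) (cts′ , e′)
  Bicolored-≡ {cts} {e = e} {e′} refl = cong (cts ,_) (≡-irrelevant e e′)

  DoublyRooted-≡ : ∀ {t t′ v v′} {e : edges t ≡ n} {e′ : edges t′ ≡ n} →
                   _≡_ {A = Pointed} (t , v) (t′ , v′) →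
                   _≡_ {A = DoublyRooted n} (t , e , v) (t′ , e′ , v′)
  DoublyRooted-≡ {t} {v = v} {e = e} {e′} refl = cong (λ e → t , e , v) (≡-irrelevant e e′)

theorem2p3 : (n : ℕ) → DoublyRooted n ⤖ Bicolored n
theorem2p3 n = ↔⇒⤖ (mk↔ₛ′ to from to∘from from∘to)
  where
  to : DoublyRooted n → Bicolored n
  to (t , e , v) = spine t v , trans (edgesB-spine t v) e

  from : Bicolored n → DoublyRooted n
  from (cts , e) = proj₁ (rebuild cts) , trans (edges-rebuild cts) e , proj₂ (rebuild cts)

  to∘from : ∀ y → to (from y) ≡ y
  to∘from (cts , _) = Bicolored-≡ (spine-rebuild cts)

  from∘to : ∀ x → from (to x) ≡ x
  from∘to (t , _ , v) = DoublyRooted-≡ (rebuild-spine t v)
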